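{- Let $K$ be a number field with ring of algebraic integers $O_K$, and let $A_1,A_2,S,T\in O_K$ with $A_1\neq A_2$ and $S\neq 0$. Then the following are equivalent: (i) $A_1=\alpha_1^2$ and $A_2=\alpha_2^2$ for some $\alpha_1,\alpha_2\in O_K$, and $S$ divides $T$ in $O_K$; (ii) there exists $m\in O_K$ such that $$(T-mS)^4-2(A_1+A_2)S^2(T-mS)^2+(A_1-A_2)^2S^4=0.$$ -}

module Defs where

open import Level using (Level; _⊔_) renaming (suc to lsuc)
open import Data.Nat using (ℕ; zero; suc)
open import Data.Fin using (Fin)
import Data.Fin as Fin
open import Data.Integer using (ℤ)
open import Data.Rational using (ℚ; 0ℚ; 1ℚ) renaming (_+_ to _+ℚ_; _*_ to _*ℚ_; _/_ to _/ℚ_)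
open import Data.Product using (Σ; ∃; _×_)
open import Relation.Nullary using (¬_)
open import Relation.Binary.PropositionalEquality using (_≡_)
open import Algebra.Bundles using (CommutativeRing)

sumR : ∀ {c ℓ} (R : CommutativeRing c ℓ) → let open CommutativeRing R in
       ∀ {n} → (Fin n → Carrier) → Carrier
sumR R {zero}  f = CommutativeRing.0# R
sumR R {suc n} f = CommutativeRing._+_ R (f Fin.zero) (sumR R (λ i → f (Fin.suc i)))

record NumberField (c ℓ : Level) : Set (lsuc (c ⊔ ℓ)) where
  field
    commRing : CommutativeRing c ℓ
  open CommutativeRing commRing public

  ∑ : ∀ {n} → (Fin n → Carrier) → Carrier
  ∑ = sumR commRing

  field
    1≉0     : ¬ (1# ≈ 0#)
    inverse : ∀ x → ¬ (x ≈ 0#) → ∃ λ y → x * y ≈ 1#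
    ι       : ℚ → Carrier
    ι-1     : ι 1ℚ ≈ 1#
    ι-+     : ∀ p q → ι (p +ℚ q) ≈ ι p + ι q
    ι-*     : ∀ p q → ι (p *ℚ q) ≈ ι p * ι q
    dim       : ℕ
    basis     : Fin dim → Carrier
    spanning  : ∀ x → ∃ λ (a : Fin dim → ℚ) → x ≈ ∑ (λ i → ι (a i) * basis i)
    independent : ∀ (a : Fin dim → ℚ) → ∑ (λ i → ι (a i) * basis i) ≈ 0# →
                  ∀ i → a i ≡ 0ℚ

  _^_ : Carrier → ℕ → Carrier
  x ^ zero  = 1#
  x ^ suc n = x * (x ^ n)

  ιℤ : ℤ → Carrier
  ιℤ z = ι (z /ℚ 1)

  IsAlgInt : Carrier → Set ℓ
  IsAlgInt x = Σ ℕ λ n → Σ (Fin n → ℤ) λ a →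
    (x ^ n) + ∑ (λ i → ιℤ (a i) * (x ^ Fin.toℕ i)) ≈ 0#

  _∣O_ : Carrier → Carrier → Set (c ⊔ ℓ)
  s ∣O t = ∃ λ m → IsAlgInt m × (t ≈ m * s)

  IsSquareO : Carrier → Set (c ⊔ ℓ)
  IsSquareO a = ∃ λ α → IsAlgInt α × (a ≈ α * α)

  2# : Carrier
  2# = 1# + 1#

module Submission where

-- (i) ⇒ (ii): if Aᵢ = αᵢ² and T = kS, the quartic in u = T − mS is the product of the four
-- factors u ± α₁S ± α₂S, so m = k − α₁ − α₂ gives the root u = (α₁ + α₂)S.
-- (ii) ⇒ (i): x = (T − mS)/S is a root of x⁴ − 2(A₁ + A₂)x² + (A₁ − A₂)², nonzero since A₁ ≠ A₂,
-- and αᵢ = (x² ± (A₁ − A₂))/2x satisfy αᵢ² = Aᵢ and α₁ + α₂ = x, whence T = (m + α₁ + α₂)S.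
-- The integrality of m − α₁ − α₂, of the square roots αᵢ and of m + α₁ + α₂ comes from the
-- module criterion: z is integral once it maps a finitely generated ℤ-module containing 1 into
-- itself (the determinant trick, carried out by fraction-free elimination). The modules used are
-- ℤ[x]·ℤ[y] for x ± y and ℤ[α] of rank 2n for α² = A with A of degree n.

open import Level using (Level; _⊔_)
open import Data.Nat as ℕ using (ℕ; zero; suc; _<_)
import Data.Nat.Properties as ℕ
open import Data.Fin as Fin using (Fin; toℕ; inject₁; fromℕ)
import Data.Fin.Properties as Fin
open import Data.Integer as ℤ using (ℤ)
import Data.Integer.Properties as ℤ
open import Data.Rational as ℚ using (_/_; fromℚᵘ)
open import Data.Rational.Properties
  using (toℚᵘ-injective; toℚᵘ-fromℚᵘ; toℚᵘ-homo-+; toℚᵘ-homo-*; fromℚᵘ-cong)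
import Data.Rational.Unnormalised as ℚᵘ
import Data.Rational.Unnormalised.Properties as ℚᵘ
open import Data.Product using (∃; ∃₂; _×_; _,_; proj₁; proj₂)
open import Data.Sum using (inj₁; inj₂)
open import Data.Empty using (⊥-elim)
open import Data.Maybe using (just; nothing)
open import Data.Vec.Functional using (Vector; init)
open import Relation.Nullary using (¬_; yes; no)
open import Relation.Binary.PropositionalEquality as ≡ using (_≡_; _≢_)
open import Relation.Binary.Definitions using (WeaklyDecidable)
import Algebra.Solver.Ring.AlmostCommutativeRing as ACR
import Algebra.Solver.Ring
open import Defs

fromℚᵘ-homo-+ : ∀ p q → fromℚᵘ (p ℚᵘ.+ q) ≡ fromℚᵘ p ℚ.+ fromℚᵘ q
fromℚᵘ-homo-+ p q = toℚᵘ-injective (ℚᵘ.≃-trans (toℚᵘ-fromℚᵘ (p ℚᵘ.+ q))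
  (ℚᵘ.≃-sym (ℚᵘ.≃-trans (toℚᵘ-homo-+ (fromℚᵘ p) (fromℚᵘ q))
    (ℚᵘ.+-cong (toℚᵘ-fromℚᵘ p) (toℚᵘ-fromℚᵘ q)))))

fromℚᵘ-homo-* : ∀ p q → fromℚᵘ (p ℚᵘ.* q) ≡ fromℚᵘ p ℚ.* fromℚᵘ q
fromℚᵘ-homo-* p q = toℚᵘ-injective (ℚᵘ.≃-trans (toℚᵘ-fromℚᵘ (p ℚᵘ.* q))
  (ℚᵘ.≃-sym (ℚᵘ.≃-trans (toℚᵘ-homo-* (fromℚᵘ p) (fromℚᵘ q))
    (ℚᵘ.*-cong (toℚᵘ-fromℚᵘ p) (toℚᵘ-fromℚᵘ q)))))

/1-homo-+ : ∀ a b → (a ℤ.+ b) / 1 ≡ a / 1 ℚ.+ b / 1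
/1-homo-+ a b = ≡.trans (fromℚᵘ-cong {ℚᵘ.mkℚᵘ (a ℤ.+ b) 0} {a/1 ℚᵘ.+ b/1} (ℚᵘ.*≡* numerators))
  (fromℚᵘ-homo-+ a/1 b/1)
  where
  a/1 b/1 : ℚᵘ.ℚᵘ
  a/1 = ℚᵘ.mkℚᵘ a 0
  b/1 = ℚᵘ.mkℚᵘ b 0

  numerators : (a ℤ.+ b) ℤ.* ℤ.+ 1 ≡ (a ℤ.* ℤ.+ 1 ℤ.+ b ℤ.* ℤ.+ 1) ℤ.* ℤ.+ 1
  numerators = ≡.cong (ℤ._* ℤ.+ 1)
    (≡.sym (≡.cong₂ ℤ._+_ (ℤ.*-identityʳ a) (ℤ.*-identityʳ b)))

/1-homo-* : ∀ a b → (a ℤ.* b) / 1 ≡ (a / 1) ℚ.* (b / 1)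
/1-homo-* a b = ≡.trans (fromℚᵘ-cong {ℚᵘ.mkℚᵘ (a ℤ.* b) 0} {ℚᵘ.mkℚᵘ a 0 ℚᵘ.* ℚᵘ.mkℚᵘ b 0} (ℚᵘ.*≡* ≡.refl))
  (fromℚᵘ-homo-* (ℚᵘ.mkℚᵘ a 0) (ℚᵘ.mkℚᵘ b 0))

δ : ∀ {n} → Fin n → Fin n → ℤ
δ Fin.zero    Fin.zero    = ℤ.+ 1
δ Fin.zero    (Fin.suc j) = ℤ.+ 0
δ (Fin.suc i) Fin.zero    = ℤ.+ 0
δ (Fin.suc i) (Fin.suc j) = δ i j

δ-diag : ∀ {n} (i : Fin n) → δ i i ≡ ℤ.+ 1
δ-diag Fin.zero    = ≡.refl
δ-diag (Fin.suc i) = δ-diag i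

δ-off : ∀ {n} {i j : Fin n} → i ≢ j → δ i j ≡ ℤ.+ 0
δ-off {i = Fin.zero}  {Fin.zero}  i≢j = ⊥-elim (i≢j ≡.refl)
δ-off {i = Fin.zero}  {Fin.suc j} i≢j = ≡.refl
δ-off {i = Fin.suc i} {Fin.zero}  i≢j = ≡.refl
δ-off {i = Fin.suc i} {Fin.suc j} i≢j = δ-off (λ i≡j → i≢j (≡.cong Fin.suc i≡j))

module NumberFieldProperties {c ℓ : Level} (K : NumberField c ℓ) where
  open NumberField K
  open import Algebra.Properties.Group +-group
    using (identityˡ-unique; inverseˡ-unique; x∙y⁻¹≈ε⇒x≈y)
  open import Algebra.Properties.Ring ring using (-1*x≈-x; -‿distribˡ-*)
  open import Algebra.Properties.Semiring.Sum semiring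
    using (sum; sum-cong-≋; sum-init-last; ∑-distrib-+; *-distribˡ-sum)
  open import Relation.Binary.Reasoning.Setoid setoid

  ιℤ-0 : ιℤ (ℤ.+ 0) ≈ 0#
  ιℤ-0 = identityˡ-unique _ _ (sym (ι-+ ℚ.0ℚ ℚ.0ℚ))

  ιℤ-+ : ∀ a b → ιℤ (a ℤ.+ b) ≈ ιℤ a + ιℤ b
  ιℤ-+ a b = trans (reflexive (≡.cong ι (/1-homo-+ a b))) (ι-+ _ _)

  ιℤ-* : ∀ a b → ιℤ (a ℤ.* b) ≈ ιℤ a * ιℤ b
  ιℤ-* a b = trans (reflexive (≡.cong ι (/1-homo-* a b))) (ι-* _ _)

  ιℤ-‿ : ∀ a → ιℤ (ℤ.- a) ≈ - ιℤ a
  ιℤ-‿ a = inverseˡ-unique _ _ (trans (+-comm _ _) (begin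
    ιℤ a + ιℤ (ℤ.- a)   ≈⟨ ιℤ-+ a (ℤ.- a) ⟨
    ιℤ (a ℤ.+ ℤ.- a)    ≡⟨ ≡.cong ιℤ (ℤ.+-inverseʳ a) ⟩
    ιℤ (ℤ.+ 0)          ≈⟨ ιℤ-0 ⟩
    0#                  ∎))

  ιℤ-morphism : ℤ.+-*-rawRing ACR.-Raw-AlmostCommutative⟶ ACR.fromCommutativeRing commRing
  ιℤ-morphism = record
    { ⟦_⟧ = ιℤ ; +-homo = ιℤ-+ ; *-homo = ιℤ-* ; -‿homo = ιℤ-‿ ; 0-homo = ιℤ-0 ; 1-homo = ι-1 }

  ιℤ-≟ : WeaklyDecidable (ACR.Induced-equivalence ιℤ-morphism)
  ιℤ-≟ a b with a ℤ.≟ b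
  ... | yes ≡.refl = just refl
  ... | no _       = nothing

  open Algebra.Solver.Ring ℤ.+-*-rawRing (ACR.fromCommutativeRing commRing) ιℤ-morphism ιℤ-≟
    using (solve; Polynomial; con; var; _:+_; _:-_; _:*_; _:^_; :-_; _:=_)

  -- The solver reads `con k` as ιℤ k, which is not definitionally 1# or 2#.
  :1 :2 : ∀ {n} → Polynomial (suc n)
  :1 = var Fin.zero :^ 0
  :2 = :1 :+ :1

  ^-cong : ∀ {x y} n → x ≈ y → x ^ n ≈ y ^ n
  ^-cong zero    x≈y = refl
  ^-cong (suc n) x≈y = *-cong x≈y (^-cong n x≈y)

  ^-+ : ∀ x m n → x ^ (m ℕ.+ n) ≈ x ^ m * x ^ n
  ^-+ x zero    n = sym (*-identityˡ _)
  ^-+ x (suc m) n = trans (*-congˡ (^-+ x m n)) (sym (*-assoc _ _ _))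

  ^-distribʳ-* : ∀ x y n → (x * y) ^ n ≈ x ^ n * y ^ n
  ^-distribʳ-* x y zero    = sym (*-identityˡ 1#)
  ^-distribʳ-* x y (suc n) = trans (*-congˡ (^-distribʳ-* x y n))
    (solve 4 (λ x y u v → (x :* y) :* (u :* v) := (x :* u) :* (y :* v)) refl x y (x ^ n) (y ^ n))

  ∑≡sum : ∀ {n} (f : Vector Carrier n) → ∑ f ≡ sum f
  ∑≡sum {zero}  f = ≡.refl
  ∑≡sum {suc n} f = ≡.cong (f Fin.zero +_) (∑≡sum (λ i → f (Fin.suc i)))

  sum-linear : ∀ {n} x y (f g : Vector Carrier n) →
               sum (λ j → x * f j + y * g j) ≈ x * sum f + y * sum g
  sum-linear x y f g = trans (∑-distrib-+ (λ j → x * f j) (λ j → y * g j))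
    (sym (+-cong (*-distribˡ-sum x f) (*-distribˡ-sum y g)))

  sum-zero-combination : ∀ {n} (g : Vector Carrier n) → sum (λ j → ιℤ (ℤ.+ 0) * g j) ≈ 0#
  sum-zero-combination {zero}  g = refl
  sum-zero-combination {suc n} g =
    trans (+-cong (trans (*-congʳ ιℤ-0) (zeroˡ _)) (sum-zero-combination (λ j → g (Fin.suc j))))
          (+-identityʳ 0#)

  sum-δ : ∀ {n} (i : Fin n) (g : Vector Carrier n) → sum (λ j → ιℤ (δ i j) * g j) ≈ g i
  sum-δ Fin.zero g = begin
    ιℤ (ℤ.+ 1) * g Fin.zero + sum (λ j → ιℤ (ℤ.+ 0) * g (Fin.suc j))
      ≈⟨ +-cong (*-congʳ ι-1) (sum-zero-combination (λ j → g (Fin.suc j))) ⟩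
    1# * g Fin.zero + 0#  ≈⟨ +-identityʳ _ ⟩
    1# * g Fin.zero       ≈⟨ *-identityˡ _ ⟩
    g Fin.zero            ∎
  sum-δ (Fin.suc i) g = begin
    ιℤ (ℤ.+ 0) * g Fin.zero + sum (λ j → ιℤ (δ i j) * g (Fin.suc j))
      ≈⟨ +-cong (trans (*-congʳ ιℤ-0) (zeroˡ _)) (sum-δ i (λ j → g (Fin.suc j))) ⟩
    0# + g (Fin.suc i)  ≈⟨ +-identityˡ _ ⟩
    g (Fin.suc i)       ∎

  infix 4 _∈span_

  record _∈span_ {n} (e : Carrier) (g : Vector Carrier n) : Set ℓ where
    constructor span
    field
      coefficients : Fin n → ℤ
      ≈-combination : e ≈ sum (λ j → ιℤ (coefficients j) * g j)

  module _ {n} {g : Vector Carrier n} where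

    ∈span-resp-≈ : ∀ {e e′} → e ≈ e′ → e ∈span g → e′ ∈span g
    ∈span-resp-≈ e≈e′ (span a e≈) = span a (trans (sym e≈e′) e≈)

    0∈span : 0# ∈span g
    0∈span = span (λ _ → ℤ.+ 0) (sym (sum-zero-combination g))

    gen∈span : ∀ i → g i ∈span g
    gen∈span i = span (δ i) (sym (sum-δ i g))

    ∈span-+ : ∀ {e e′} → e ∈span g → e′ ∈span g → e + e′ ∈span g
    ∈span-+ (span a e≈) (span b e′≈) = span (λ j → a j ℤ.+ b j) (begin
      _ + _  ≈⟨ +-cong e≈ e′≈ ⟩
      sum (λ j → ιℤ (a j) * g j) + sum (λ j → ιℤ (b j) * g j)
        ≈⟨ ∑-distrib-+ (λ j → ιℤ (a j) * g j) (λ j → ιℤ (b j) * g j) ⟨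
      sum (λ j → ιℤ (a j) * g j + ιℤ (b j) * g j)
        ≈⟨ sum-cong-≋ (λ j → trans (*-congʳ (ιℤ-+ (a j) (b j))) (distribʳ _ _ _)) ⟨
      sum (λ j → ιℤ (a j ℤ.+ b j) * g j)  ∎)

    ∈span-ιℤ* : ∀ k {e} → e ∈span g → ιℤ k * e ∈span g
    ∈span-ιℤ* k (span a e≈) = span (λ j → k ℤ.* a j) (begin
      ιℤ k * _                                   ≈⟨ *-congˡ e≈ ⟩
      ιℤ k * sum (λ j → ιℤ (a j) * g j)          ≈⟨ *-distribˡ-sum (ιℤ k) (λ j → ιℤ (a j) * g j) ⟩
      sum (λ j → ιℤ k * (ιℤ (a j) * g j))
        ≈⟨ sum-cong-≋ (λ j → trans (sym (*-assoc _ _ _)) (*-congʳ (sym (ιℤ-* k (a j))))) ⟩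
      sum (λ j → ιℤ (k ℤ.* a j) * g j)           ∎)

    ∈span-‿ : ∀ {e} → e ∈span g → - e ∈span g
    ∈span-‿ e∈ = ∈span-resp-≈ (trans (*-congʳ (ιℤ-‿ (ℤ.+ 1))) (trans (*-congʳ (-‿cong ι-1)) (-1*x≈-x _)))
                              (∈span-ιℤ* (ℤ.- ℤ.+ 1) e∈)

    ∈span-- : ∀ {e e′} → e ∈span g → e′ ∈span g → e - e′ ∈span g
    ∈span-- e∈ e′∈ = ∈span-+ e∈ (∈span-‿ e′∈)

    ∈span-sum : ∀ {m} (f : Vector Carrier m) → (∀ i → f i ∈span g) → sum f ∈span g
    ∈span-sum {zero}  f f∈ = 0∈span
    ∈span-sum {suc m} f f∈ = ∈span-+ (f∈ Fin.zero) (∈span-sum (λ i → f (Fin.suc i)) (λ i → f∈ (Fin.suc i)))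

  ∈span-map : ∀ {m n} {g : Vector Carrier m} {h : Vector Carrier n} {u e} →
              (∀ j → u * g j ∈span h) → e ∈span g → u * e ∈span h
  ∈span-map {g = g} {u = u} ug∈ (span a e≈) = ∈span-resp-≈ (begin
    sum (λ j → ιℤ (a j) * (u * g j))
      ≈⟨ sum-cong-≋ (λ j → solve 3 (λ a u g → a :* (u :* g) := u :* (a :* g)) refl (ιℤ (a j)) u (g j)) ⟩
    sum (λ j → u * (ιℤ (a j) * g j))  ≈⟨ *-distribˡ-sum u (λ j → ιℤ (a j) * g j) ⟨
    u * sum (λ j → ιℤ (a j) * g j)    ≈⟨ *-congˡ e≈ ⟨
    u * _                             ∎)
    (∈span-sum _ (λ j → ∈span-ιℤ* (a j) (ug∈ j)))

  ∈span-* : ∀ {l m n} {f : Vector Carrier l} {g : Vector Carrier m} {h : Vector Carrier n} {a b} →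
            (∀ i j → f i * g j ∈span h) → a ∈span f → b ∈span g → a * b ∈span h
  ∈span-* fg∈ a∈ b∈ =
    ∈span-map (λ j → ∈span-resp-≈ (*-comm _ _)
                       (∈span-map (λ i → ∈span-resp-≈ (*-comm _ _) (fg∈ i j)) a∈)) b∈

  ∈span-mono : ∀ {m n} {g : Vector Carrier m} {h : Vector Carrier n} {e} →
               (∀ j → g j ∈span h) → e ∈span g → e ∈span h
  ∈span-mono g∈ e∈ = ∈span-resp-≈ (*-identityˡ _)
    (∈span-map (λ j → ∈span-resp-≈ (sym (*-identityˡ _)) (g∈ j)) e∈)

  Stable : ∀ {n} → Vector Carrier n → Carrier → Set ℓ
  Stable g u = ∀ i → u * g i ∈span g

  stable-+ : ∀ {n} {g : Vector Carrier n} {u w} → Stable g u → Stable g w → Stable g (u + w)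
  stable-+ u-st w-st i = ∈span-resp-≈ (sym (distribʳ _ _ _)) (∈span-+ (u-st i) (w-st i))

  stable-‿ : ∀ {n} {g : Vector Carrier n} {u} → Stable g u → Stable g (- u)
  stable-‿ u-st i = ∈span-resp-≈ (-‿distribˡ-* _ _) (∈span-‿ (u-st i))

  _⊗_ : ∀ {m n} → Vector Carrier m → Vector Carrier n → Vector Carrier (m ℕ.* n)
  (_⊗_ {m} {n} g h) k = g (proj₁ (Fin.remQuot {m} n k)) * h (proj₂ (Fin.remQuot {m} n k))

  ⊗-gen∈span : ∀ {m n} {g : Vector Carrier m} {h : Vector Carrier n} i j → g i * h j ∈span g ⊗ h
  ⊗-gen∈span {m} {n} {g} {h} i j =
    ≡.subst (λ (ij : Fin m × Fin n) → g (proj₁ ij) * h (proj₂ ij) ∈span g ⊗ h)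
            (Fin.remQuot-combine i j) (gen∈span {g = g ⊗ h} (Fin.combine i j))

  ∈span-⊗ : ∀ {m n} {g : Vector Carrier m} {h : Vector Carrier n} {a b} →
            a ∈span g → b ∈span h → a * b ∈span g ⊗ h
  ∈span-⊗ {g = g} {h} = ∈span-* {h = g ⊗ h} ⊗-gen∈span

  stable-⊗ˡ : ∀ {m n} {g : Vector Carrier m} {h : Vector Carrier n} {u} → Stable g u → Stable (g ⊗ h) u
  stable-⊗ˡ {m} {n} {g} {h} u-st k =
    ∈span-resp-≈ (*-assoc _ _ _) (∈span-⊗ {g = g} {h} (u-st (proj₁ (Fin.remQuot {m} n k))) (gen∈span _))

  stable-⊗ʳ : ∀ {m n} {g : Vector Carrier m} {h : Vector Carrier n} {u} → Stable h u → Stable (g ⊗ h) u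
  stable-⊗ʳ {m} {n} {g} {h} {u} u-st k =
    ∈span-resp-≈ (solve 3 (λ a b u → a :* (u :* b) := u :* (a :* b)) refl (g i) (h j) u)
                 (∈span-⊗ {g = g} {h} (gen∈span i) (u-st j))
    where
    i = proj₁ (Fin.remQuot {m} n k)
    j = proj₂ (Fin.remQuot {m} n k)

  powers : Carrier → (n : ℕ) → Vector Carrier n
  powers z n i = z ^ toℕ i

  ^∈powers : ∀ {z k n} → k < n → z ^ k ∈span powers z n
  ^∈powers {z} {n = n} k<n =
    ≡.subst (λ k → z ^ k ∈span powers z n) (Fin.toℕ-fromℕ< k<n) (gen∈span (Fin.fromℕ< k<n))

  powers-stable : ∀ {z n} → z ^ n ∈span powers z n → Stable (powers z n) z
  powers-stable {z} {n} zⁿ∈ i with ℕ.m≤n⇒m<n∨m≡n (Fin.toℕ<n i)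
  ... | inj₁ i+1<n = ^∈powers i+1<n
  ... | inj₂ i+1≡n = ≡.subst (λ k → z ^ k ∈span powers z n) (≡.sym i+1≡n) zⁿ∈

  powers-* : ∀ {z m n a b} → a ∈span powers z m → b ∈span powers z n → a * b ∈span powers z (m ℕ.+ n)
  powers-* = ∈span-* (λ i j → ∈span-resp-≈ (^-+ _ (toℕ i) (toℕ j))
                                            (^∈powers (ℕ.+-mono-< (Fin.toℕ<n i) (Fin.toℕ<n j))))

  powers-shift : ∀ {z n b} m → b ∈span powers z n → z ^ m * b ∈span powers z (m ℕ.+ n)
  powers-shift m = ∈span-map (λ j → ∈span-resp-≈ (^-+ _ m (toℕ j))
                                                  (^∈powers (ℕ.+-monoʳ-< m (Fin.toℕ<n j))))

  Monic : Carrier → ℕ → Carrier → Set (c ⊔ ℓ)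
  Monic z n e = ∃ λ q → q ∈span powers z n × e ≈ z ^ n + q

  monic-resp-≈ : ∀ {z n e e′} → e ≈ e′ → Monic z n e → Monic z n e′
  monic-resp-≈ e≈e′ (q , q∈ , e≈) = q , q∈ , trans (sym e≈e′) e≈

  monic-- : ∀ {z n a b} → Monic z n a → b ∈span powers z n → Monic z n (a - b)
  monic-- (q , q∈ , a≈) b∈ = q - _ , ∈span-- q∈ b∈ , trans (+-congʳ a≈) (+-assoc _ _ _)

  monic-*-∈powers : ∀ {z n a b} → Monic z n a → b ∈span powers z n → a * b ∈span powers z (n ℕ.+ n)
  monic-*-∈powers {n = n} (q , q∈ , a≈) b∈ =
    ∈span-resp-≈ (sym (trans (*-congʳ a≈) (distribʳ _ _ _)))
                 (∈span-+ (powers-shift n b∈) (powers-* q∈ b∈))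

  monic-*-monic : ∀ {z n a b} → Monic z n a → Monic z n b → Monic z (n ℕ.+ n) (a * b)
  monic-*-monic {z} {n} {a} {b} a-monic@(p , p∈ , a≈) (q , q∈ , b≈) =
    z ^ n * p + a * q , ∈span-+ (powers-shift n p∈) (monic-*-∈powers a-monic q∈) , (begin
      a * b                                ≈⟨ *-congˡ b≈ ⟩
      a * (z ^ n + q)                      ≈⟨ distribˡ _ _ _ ⟩
      a * z ^ n + a * q                    ≈⟨ +-congʳ (*-congʳ a≈) ⟩
      (z ^ n + p) * z ^ n + a * q
        ≈⟨ solve 4 (λ Z p a q → (Z :+ p) :* Z :+ a :* q := Z :* Z :+ (Z :* p :+ a :* q))
                   refl (z ^ n) p a q ⟩
      z ^ n * z ^ n + (z ^ n * p + a * q)  ≈⟨ +-congʳ (^-+ z n n) ⟨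
      z ^ (n ℕ.+ n) + (z ^ n * p + a * q)  ∎)

  Matrix : ℕ → Set c
  Matrix n = Fin n → Fin n → Carrier

  _*ᵥ_ : ∀ {n} → Matrix n → Vector Carrier n → Vector Carrier n
  (B *ᵥ v) i = sum (λ j → B i j * v j)

  MonicMatrix : ∀ {n} → Carrier → ℕ → Matrix n → Set (c ⊔ ℓ)
  MonicMatrix z d B = (∀ i → Monic z d (B i i)) × (∀ {i j} → i ≢ j → B i j ∈span powers z d)

  -- One step of fraction-free Gaussian elimination, pivoting on the last entry.
  pivot : ∀ {n} → Matrix (suc (suc n)) → Matrix (suc n)
  pivot {n} B i j = B p p * B (inject₁ i) (inject₁ j) - B (inject₁ i) p * B p (inject₁ j)
    where p = fromℕ (suc n)

  monicMatrix-pivot : ∀ {n z d} {B : Matrix (suc (suc n))} →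
                      MonicMatrix z d B → MonicMatrix z (d ℕ.+ d) (pivot B)
  monicMatrix-pivot (diag , off) =
    (λ i → monic-- (monic-*-monic (diag _) (diag _)) (powers-* (off inject₁≢p) (off p≢inject₁))) ,
    (λ i≢j → ∈span-- (monic-*-∈powers (diag _) (off (λ eq → i≢j (Fin.inject₁-injective eq))))
                     (powers-* (off inject₁≢p) (off p≢inject₁)))
    where
    p≢inject₁ : ∀ {n} {i : Fin (suc n)} → fromℕ (suc n) ≢ inject₁ i
    p≢inject₁ = Fin.fromℕ≢inject₁
    inject₁≢p : ∀ {n} {i : Fin (suc n)} → inject₁ i ≢ fromℕ (suc n)
    inject₁≢p eq = Fin.fromℕ≢inject₁ (≡.sym eq)

  pivot-preserves-kernel : ∀ {n} (B : Matrix (suc (suc n))) v →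
                           (∀ i → (B *ᵥ v) i ≈ 0#) → ∀ i → (pivot B *ᵥ init v) i ≈ 0#
  pivot-preserves-kernel {n} B v B*v≈0 i = begin
    (pivot B *ᵥ init v) i
      ≈⟨ sum-cong-≋ (λ j → solve 5 (λ a b x y w → (a :* b :- x :* y) :* w := a :* (b :* w) :+ (:- x) :* (y :* w))
                                    refl (B p p) (B i′ (inject₁ j)) (B i′ p) (B p (inject₁ j)) (v (inject₁ j))) ⟩
    sum (λ j → B p p * row i′ j + (- B i′ p) * row p j)
      ≈⟨ sum-linear (B p p) (- B i′ p) (row i′) (row p) ⟩
    B p p * sum (row i′) + (- B i′ p) * sum (row p)
      ≈⟨ +-cong (*-congˡ (sum-row i′)) (*-congˡ (sum-row p)) ⟩
    B p p * (- (B i′ p * v p)) + (- B i′ p) * (- (B p p * v p))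
      ≈⟨ solve 3 (λ a x w → a :* (:- (x :* w)) :+ (:- x) :* (:- (a :* w)) := con (ℤ.+ 0))
                 refl (B p p) (B i′ p) (v p) ⟩
    ιℤ (ℤ.+ 0)
      ≈⟨ ιℤ-0 ⟩
    0#  ∎
    where
    p = fromℕ (suc n)
    i′ = inject₁ i
    row : Fin (suc (suc n)) → Vector Carrier (suc n)
    row r j = B r (inject₁ j) * v (inject₁ j)
    sum-row : ∀ r → sum (row r) ≈ - (B r p * v p)
    sum-row r = inverseˡ-unique _ _ (trans (sym (sum-init-last (λ j → B r j * v j))) (B*v≈0 r))

  monicMatrix-kernel⇒root : ∀ {n z d} {B : Matrix (suc n)} {v} → MonicMatrix z d B →
                             (∀ i → (B *ᵥ v) i ≈ 0#) → v Fin.zero ≈ 1# → ∃ λ d′ → Monic z d′ 0#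
  monicMatrix-kernel⇒root {zero} {d = d} {B} {v} (diag , _) B*v≈0 v₀≈1 =
    d , monic-resp-≈ B₀₀≈0 (diag Fin.zero)
    where
    B₀₀≈0 : B Fin.zero Fin.zero ≈ 0#
    B₀₀≈0 = begin
      B Fin.zero Fin.zero                      ≈⟨ *-identityʳ _ ⟨
      B Fin.zero Fin.zero * 1#                 ≈⟨ *-congˡ v₀≈1 ⟨
      B Fin.zero Fin.zero * v Fin.zero         ≈⟨ +-identityʳ _ ⟨
      B Fin.zero Fin.zero * v Fin.zero + 0#    ≈⟨ B*v≈0 Fin.zero ⟩
      0#                                       ∎
  monicMatrix-kernel⇒root {suc n} {B = B} {v} B-monic B*v≈0 v₀≈1 =
    monicMatrix-kernel⇒root {v = init v} (monicMatrix-pivot B-monic) (pivot-preserves-kernel B v B*v≈0) v₀≈1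

  monic-zero⇒isAlgInt : ∀ {z d} → Monic z d 0# → IsAlgInt z
  monic-zero⇒isAlgInt {z} {d} (q , span a q≈ , 0≈) = d , a , (begin
    z ^ d + ∑ (λ i → ιℤ (a i) * z ^ toℕ i)    ≡⟨ ≡.cong (z ^ d +_) (∑≡sum (λ i → ιℤ (a i) * z ^ toℕ i)) ⟩
    z ^ d + sum (λ i → ιℤ (a i) * z ^ toℕ i)  ≈⟨ +-congˡ q≈ ⟨
    z ^ d + q                                 ≈⟨ 0≈ ⟨
    0#                                        ∎)

  isAlgInt⇒^∈powers : ∀ {z} → IsAlgInt z → ∃ λ n → z ^ suc n ∈span powers z (suc n)
  isAlgInt⇒^∈powers (zero , a , 1+0≈0) = ⊥-elim (1≉0 (trans (sym (+-identityʳ 1#)) 1+0≈0))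
  isAlgInt⇒^∈powers {z} (suc n , a , root) =
    n , ∈span-resp-≈ (sym (inverseˡ-unique _ _ root))
                     (∈span-‿ (span a (reflexive (∑≡sum (λ i → ιℤ (a i) * z ^ toℕ i)))))

  ιℤ∈powers₁ : ∀ {z} k → ιℤ k ∈span powers z 1
  ιℤ∈powers₁ k = span (λ _ → k) (sym (trans (+-identityʳ _) (*-identityʳ _)))

  -- The determinant trick: z acts on the ℤ-module spanned by g through an integer matrix a,
  -- so the matrix z·I − a annihilates the vector g, whose first entry is 1.
  stable⇒isAlgInt : ∀ {n z} (g : Vector Carrier (suc n)) → g Fin.zero ≈ 1# → Stable g z → IsAlgInt z
  stable⇒isAlgInt {n} {z} g g₀≈1 z-st =
    monic-zero⇒isAlgInt (proj₂ (monicMatrix-kernel⇒root {v = g} (diag , off) B*g≈0 g₀≈1))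
    where
    a : Fin (suc n) → Fin (suc n) → ℤ
    a i = _∈span_.coefficients (z-st i)
    B : Matrix (suc n)
    B i j = ιℤ (δ i j) * z - ιℤ (a i j)
    diag : ∀ i → Monic z 1 (B i i)
    diag i = - ιℤ (a i i) , ∈span-‿ (ιℤ∈powers₁ (a i i)) ,
      +-congʳ (trans (*-congʳ (trans (reflexive (≡.cong ιℤ (δ-diag i))) ι-1))
                     (trans (*-identityˡ z) (sym (*-identityʳ z))))
    off : ∀ {i j} → i ≢ j → B i j ∈span powers z 1
    off {i} {j} i≢j = ∈span-resp-≈ (sym (begin
      ιℤ (δ i j) * z - ιℤ (a i j)  ≈⟨ +-congʳ (*-congʳ (reflexive (≡.cong ιℤ (δ-off i≢j)))) ⟩
      ιℤ (ℤ.+ 0) * z - ιℤ (a i j)  ≈⟨ +-congʳ (trans (*-congʳ ιℤ-0) (zeroˡ z)) ⟩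
      0# - ιℤ (a i j)              ≈⟨ +-identityˡ _ ⟩
      - ιℤ (a i j)                 ∎))
      (∈span-‿ (ιℤ∈powers₁ (a i j)))
    B*g≈0 : ∀ i → (B *ᵥ g) i ≈ 0#
    B*g≈0 i = begin
      sum (λ j → (ιℤ (δ i j) * z - ιℤ (a i j)) * g j)
        ≈⟨ sum-cong-≋ (λ j → solve 4 (λ d z a g → (d :* z :- a) :* g := z :* (d :* g) :+ (:- :1) :* (a :* g))
                                      refl (ιℤ (δ i j)) z (ιℤ (a i j)) (g j)) ⟩
      sum (λ j → z * (ιℤ (δ i j) * g j) + (- 1#) * (ιℤ (a i j) * g j))
        ≈⟨ sum-linear z (- 1#) (λ j → ιℤ (δ i j) * g j) (λ j → ιℤ (a i j) * g j) ⟩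
      z * sum (λ j → ιℤ (δ i j) * g j) + (- 1#) * sum (λ j → ιℤ (a i j) * g j)
        ≈⟨ +-cong (*-congˡ (sum-δ i g)) (*-congˡ (sym (_∈span_.≈-combination (z-st i)))) ⟩
      z * g i + (- 1#) * (z * g i)
        ≈⟨ solve 1 (λ x → x :+ (:- :1) :* x := con (ℤ.+ 0)) refl (z * g i) ⟩
      ιℤ (ℤ.+ 0)  ≈⟨ ιℤ-0 ⟩
      0#          ∎

  isAlgInt-‿ : ∀ {x} → IsAlgInt x → IsAlgInt (- x)
  isAlgInt-‿ {x} x-int with isAlgInt⇒^∈powers x-int
  ... | n , xⁿ∈ = stable⇒isAlgInt (powers x (suc n)) refl (stable-‿ (powers-stable xⁿ∈))

  isAlgInt-+ : ∀ {x y} → IsAlgInt x → IsAlgInt y → IsAlgInt (x + y)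
  isAlgInt-+ {x} {y} x-int y-int with isAlgInt⇒^∈powers x-int | isAlgInt⇒^∈powers y-int
  ... | m , xᵐ∈ | n , yⁿ∈ =
    stable⇒isAlgInt (xs ⊗ ys) (*-identityˡ 1#)
      (stable-+ (stable-⊗ˡ {h = ys} (powers-stable xᵐ∈)) (stable-⊗ʳ {g = xs} (powers-stable yⁿ∈)))
    where
    xs = powers x (suc m)
    ys = powers y (suc n)

  ^-double : ∀ {α A} → α * α ≈ A → ∀ k → A ^ k ≈ α ^ (k ℕ.+ k)
  ^-double {α} {A} α²≈A k = begin
    A ^ k          ≈⟨ ^-cong k α²≈A ⟨
    (α * α) ^ k    ≈⟨ ^-distribʳ-* α α k ⟩
    α ^ k * α ^ k  ≈⟨ ^-+ α k k ⟨
    α ^ (k ℕ.+ k)  ∎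

  isAlgInt-√ : ∀ {A α} → IsAlgInt A → α * α ≈ A → IsAlgInt α
  isAlgInt-√ {A} {α} A-int α²≈A with isAlgInt⇒^∈powers A-int
  ... | n , Aⁿ∈ = stable⇒isAlgInt (powers α (suc n ℕ.+ suc n)) refl (powers-stable α²ⁿ∈)
    where
    α²ⁿ∈ : α ^ (suc n ℕ.+ suc n) ∈span powers α (suc n ℕ.+ suc n)
    α²ⁿ∈ = ∈span-resp-≈ (^-double α²≈A (suc n))
      (∈span-mono (λ i → ∈span-resp-≈ (sym (^-double α²≈A (toℕ i)))
                                     (^∈powers (ℕ.+-mono-< (Fin.toℕ<n i) (Fin.toℕ<n i))))
                  Aⁿ∈)

  x≈kS⇒x-[k-s]S≈sS : ∀ {x k S} s → x ≈ k * S → x - (k - s) * S ≈ s * S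
  x≈kS⇒x-[k-s]S≈sS {x} {k} {S} s x≈kS =
    trans (+-congʳ x≈kS) (solve 3 (λ k s S → k :* S :- (k :- s) :* S := s :* S) refl k s S)

  x≈[m+[x-mS]t]S : ∀ {x m S t q} → S * t ≈ 1# → q ≈ (x - m * S) * t → x ≈ (m + q) * S
  x≈[m+[x-mS]t]S {x} {m} {S} {t} {q} St≈1 q≈ = sym (begin
    (m + q) * S                    ≈⟨ *-congʳ (+-congˡ q≈) ⟩
    (m + (x - m * S) * t) * S
      ≈⟨ solve 4 (λ x m S t → (m :+ (x :- m :* S) :* t) :* S := m :* S :+ (x :- m :* S) :* (S :* t)) refl x m S t ⟩
    m * S + (x - m * S) * (S * t)  ≈⟨ +-congˡ (trans (*-congˡ St≈1) (*-identityʳ _)) ⟩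
    m * S + (x - m * S)            ≈⟨ solve 2 (λ a x → a :+ (x :- a) := x) refl (m * S) x ⟩
    x                              ∎)

  quartic : Carrier → Carrier → Carrier → Carrier → Carrier
  quartic A₁ A₂ S u = (u ^ 4) - 2# * (A₁ + A₂) * (S ^ 2) * (u ^ 2) + ((A₁ - A₂) ^ 2) * (S ^ 4)

  quartic-cong : ∀ {A₁ A₁′ A₂ A₂′ S S′ u u′} → A₁ ≈ A₁′ → A₂ ≈ A₂′ → S ≈ S′ → u ≈ u′ →
                 quartic A₁ A₂ S u ≈ quartic A₁′ A₂′ S′ u′
  quartic-cong A₁≈ A₂≈ S≈ u≈ = +-cong
    (+-cong (^-cong 4 u≈) (-‿cong (*-cong (*-cong (*-congˡ (+-cong A₁≈ A₂≈)) (^-cong 2 S≈)) (^-cong 2 u≈))))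
    (*-cong (^-cong 2 (+-cong A₁≈ (-‿cong A₂≈))) (^-cong 4 S≈))

  quartic-sym : ∀ A₁ A₂ S u → quartic A₁ A₂ S u ≈ quartic A₂ A₁ S u
  quartic-sym = solve 4 (λ a b s u →
    (u :^ 4) :- :2 :* (a :+ b) :* (s :^ 2) :* (u :^ 2) :+ ((a :- b) :^ 2) :* (s :^ 4) :=
    (u :^ 4) :- :2 :* (b :+ a) :* (s :^ 2) :* (u :^ 2) :+ ((b :- a) :^ 2) :* (s :^ 4)) refl

  quartic-homogeneous : ∀ A₁ A₂ S u t → quartic A₁ A₂ (S * t) (u * t) ≈ t ^ 4 * quartic A₁ A₂ S u
  quartic-homogeneous = solve 5 (λ a b s u t →
    ((u :* t) :^ 4) :- :2 :* (a :+ b) :* ((s :* t) :^ 2) :* ((u :* t) :^ 2) :+ ((a :- b) :^ 2) :* ((s :* t) :^ 4) :=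
    (t :^ 4) :* ((u :^ 4) :- :2 :* (a :+ b) :* (s :^ 2) :* (u :^ 2) :+ ((a :- b) :^ 2) :* (s :^ 4))) refl

  quartic-root : ∀ α₁ α₂ S → quartic (α₁ * α₁) (α₂ * α₂) S ((α₁ + α₂) * S) ≈ 0#
  quartic-root α₁ α₂ S = trans (solve 3 (λ a b s →
    (((a :+ b) :* s) :^ 4) :- :2 :* (a :* a :+ b :* b) :* (s :^ 2) :* (((a :+ b) :* s) :^ 2)
      :+ ((a :* a :- b :* b) :^ 2) :* (s :^ 4) := con (ℤ.+ 0)) refl α₁ α₂ S) ιℤ-0

  quartic-dehomogenise : ∀ {A₁ A₂ S u t} → S * t ≈ 1# → quartic A₁ A₂ S u ≈ 0# →
                         quartic A₁ A₂ 1# (u * t) ≈ 0#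
  quartic-dehomogenise {A₁} {A₂} {S} {u} {t} St≈1 Q≈0 = begin
    quartic A₁ A₂ 1# (u * t)        ≈⟨ quartic-cong refl refl St≈1 refl ⟨
    quartic A₁ A₂ (S * t) (u * t)  ≈⟨ quartic-homogeneous A₁ A₂ S u t ⟩
    t ^ 4 * quartic A₁ A₂ S u      ≈⟨ *-congˡ Q≈0 ⟩
    t ^ 4 * 0#                     ≈⟨ zeroʳ _ ⟩
    0#                             ∎

  square≉0 : ∀ {x} → ¬ x ≈ 0# → ¬ x * x ≈ 0#
  square≉0 {x} x≉0 x²≈0 = 1≉0 (begin
    1#                   ≈⟨ *-identityʳ 1# ⟨
    1# * 1#              ≈⟨ *-cong xy≈1 xy≈1 ⟨
    (x * y) * (x * y)    ≈⟨ solve 2 (λ x y → (x :* y) :* (x :* y) := (x :* x) :* (y :* y)) refl x y ⟩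
    (x * x) * (y * y)    ≈⟨ *-congʳ x²≈0 ⟩
    0# * (y * y)         ≈⟨ zeroˡ _ ⟩
    0#                   ∎)
    where
    y = proj₁ (inverse x x≉0)
    xy≈1 = proj₂ (inverse x x≉0)

  ½ : Carrier
  ½ = ι (ℤ.+ 1 / 2)

  2*½≈1 : 2# * ½ ≈ 1#
  2*½≈1 = begin
    (1# + 1#) * ½    ≈⟨ distribʳ ½ 1# 1# ⟩
    1# * ½ + 1# * ½  ≈⟨ +-cong (*-identityˡ ½) (*-identityˡ ½) ⟩
    ½ + ½            ≈⟨ ι-+ (ℤ.+ 1 / 2) (ℤ.+ 1 / 2) ⟨
    ι ℚ.1ℚ           ≈⟨ ι-1 ⟩
    1#               ∎

  -- With x = α₁ + α₂ and A₁ − A₂ = α₁² − α₂² = x (α₁ − α₂), the square root α₁ is (x² + A₁ − A₂) / 2x.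
  quartic-root-square : ∀ {A₁ A₂ x y} → quartic A₁ A₂ 1# x ≈ 0# → x * y ≈ 1# →
                        ((x * x + (A₁ - A₂)) * ½ * y) * ((x * x + (A₁ - A₂)) * ½ * y) ≈ A₁
  quartic-root-square {A₁} {A₂} {x} {y} Q≈0 xy≈1 = begin
    ((x * x + (A₁ - A₂)) * ½ * y) * ((x * x + (A₁ - A₂)) * ½ * y)
      ≈⟨ solve 5 (λ a b x h y →
           ((x :* x :+ (a :- b)) :* h :* y) :* ((x :* x :+ (a :- b)) :* h :* y) :=
           (h :* y) :* (h :* y) :* ((x :^ 4) :- :2 :* (a :+ b) :* (:1 :^ 2) :* (x :^ 2) :+ ((a :- b) :^ 2) :* (:1 :^ 4))
             :+ a :* ((:2 :* h :* (x :* y)) :* (:2 :* h :* (x :* y)))) refl A₁ A₂ x ½ y ⟩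
    (½ * y) * (½ * y) * quartic A₁ A₂ 1# x + A₁ * (e * e)
      ≈⟨ +-cong (*-congˡ Q≈0) (*-congˡ (*-cong e≈1 e≈1)) ⟩
    (½ * y) * (½ * y) * 0# + A₁ * (1# * 1#)
      ≈⟨ +-cong (zeroʳ _) (*-congˡ (*-identityˡ 1#)) ⟩
    0# + A₁ * 1#   ≈⟨ +-identityˡ _ ⟩
    A₁ * 1#        ≈⟨ *-identityʳ A₁ ⟩
    A₁             ∎
    where
    e = 2# * ½ * (x * y)
    e≈1 : e ≈ 1#
    e≈1 = trans (*-cong 2*½≈1 xy≈1) (*-identityˡ 1#)

  quartic-roots : ∀ {A₁ A₂ x} → ¬ A₁ ≈ A₂ → quartic A₁ A₂ 1# x ≈ 0# →
                  ∃₂ λ α₁ α₂ → α₁ * α₁ ≈ A₁ × α₂ * α₂ ≈ A₂ × α₁ + α₂ ≈ x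
  quartic-roots {A₁} {A₂} {x} A₁≉A₂ Q≈0 =
    α₁ , α₂ , quartic-root-square Q≈0 xy≈1 ,
    quartic-root-square (trans (sym (quartic-sym A₁ A₂ 1# x)) Q≈0) xy≈1 , (begin
      α₁ + α₂         ≈⟨ solve 5 (λ a b x h y → (x :* x :+ (a :- b)) :* h :* y :+ (x :* x :+ (b :- a)) :* h :* y
                                                 := x :* (:2 :* h :* (x :* y))) refl A₁ A₂ x ½ y ⟩
      x * (2# * ½ * (x * y))  ≈⟨ *-congˡ (trans (*-cong 2*½≈1 xy≈1) (*-identityˡ 1#)) ⟩
      x * 1#          ≈⟨ *-identityʳ x ⟩
      x               ∎)
    where
    d≉0 : ¬ A₁ - A₂ ≈ 0#
    d≉0 d≈0 = A₁≉A₂ (x∙y⁻¹≈ε⇒x≈y A₁ A₂ d≈0)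
    x≉0 : ¬ x ≈ 0#
    x≉0 x≈0 = square≉0 d≉0 (begin
      (A₁ - A₂) * (A₁ - A₂)       ≈⟨ +-identityˡ _ ⟨
      0# + (A₁ - A₂) * (A₁ - A₂)  ≈⟨ +-congʳ (trans (*-congʳ x≈0) (zeroˡ _)) ⟨
      x * (x * x * x - 2# * (A₁ + A₂) * x) + (A₁ - A₂) * (A₁ - A₂)
        ≈⟨ solve 3 (λ a b x → x :* (x :* x :* x :- :2 :* (a :+ b) :* x) :+ (a :- b) :* (a :- b) :=
                              (x :^ 4) :- :2 :* (a :+ b) :* (:1 :^ 2) :* (x :^ 2) :+ ((a :- b) :^ 2) :* (:1 :^ 4))
                   refl A₁ A₂ x ⟩
      quartic A₁ A₂ 1# x          ≈⟨ Q≈0 ⟩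
      0#                          ∎)
    y = proj₁ (inverse x x≉0)
    xy≈1 = proj₂ (inverse x x≉0)
    α₁ = (x * x + (A₁ - A₂)) * ½ * y
    α₂ = (x * x + (A₂ - A₁)) * ½ * y

lemma3p1 : ∀ {c ℓ} (K : NumberField c ℓ) → let open NumberField K in
    ∀ (A₁ A₂ S T : Carrier) →
    IsAlgInt A₁ → IsAlgInt A₂ → IsAlgInt S → IsAlgInt T →
    ¬ (A₁ ≈ A₂) → ¬ (S ≈ 0#) →
    ((IsSquareO A₁ × IsSquareO A₂ × (S ∣O T)) →
      ∃ λ m → IsAlgInt m ×
        (((T - m * S) ^ 4) - 2# * (A₁ + A₂) * (S ^ 2) * ((T - m * S) ^ 2)
          + ((A₁ - A₂) ^ 2) * (S ^ 4) ≈ 0#))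
    × ((∃ λ m → IsAlgInt m ×
        (((T - m * S) ^ 4) - 2# * (A₁ + A₂) * (S ^ 2) * ((T - m * S) ^ 2)
          + ((A₁ - A₂) ^ 2) * (S ^ 4) ≈ 0#)) →
      (IsSquareO A₁ × IsSquareO A₂ × (S ∣O T)))
lemma3p1 K A₁ A₂ S T A₁-int A₂-int _ _ A₁≉A₂ S≉0 = squares⇒root , root⇒squares
  where
  open NumberField K
  open NumberFieldProperties K

  squares⇒root : IsSquareO A₁ × IsSquareO A₂ × S ∣O T →
                 ∃ λ m → IsAlgInt m × quartic A₁ A₂ S (T - m * S) ≈ 0#
  squares⇒root ((α₁ , α₁-int , A₁≈) , (α₂ , α₂-int , A₂≈) , (k , k-int , T≈kS)) =
    k - (α₁ + α₂) , isAlgInt-+ k-int (isAlgInt-‿ (isAlgInt-+ α₁-int α₂-int)) ,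
    trans (quartic-cong A₁≈ A₂≈ refl (x≈kS⇒x-[k-s]S≈sS (α₁ + α₂) T≈kS)) (quartic-root α₁ α₂ S)

  root⇒squares : (∃ λ m → IsAlgInt m × quartic A₁ A₂ S (T - m * S) ≈ 0#) →
                 IsSquareO A₁ × IsSquareO A₂ × S ∣O T
  root⇒squares (m , m-int , Q≈0) =
    let t , St≈1 = inverse S S≉0
        α₁ , α₂ , α₁²≈A₁ , α₂²≈A₂ , α₁+α₂≈x = quartic-roots A₁≉A₂ (quartic-dehomogenise St≈1 Q≈0)
        α₁-int = isAlgInt-√ A₁-int α₁²≈A₁
        α₂-int = isAlgInt-√ A₂-int α₂²≈A₂
    in (α₁ , α₁-int , sym α₁²≈A₁) , (α₂ , α₂-int , sym α₂²≈A₂) ,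
       (m + (α₁ + α₂) , isAlgInt-+ m-int (isAlgInt-+ α₁-int α₂-int) , x≈[m+[x-mS]t]S St≈1 α₁+α₂≈x)
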